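{- Let an instance of flow scheduling on a switch be given, with ports $P$, capacities $c_p$, and flows $F$ (each flow $e=pq$ having demand $d_e$, release time $r_e$, and $c_e=\min(c_p,c_q)$). Let $x$ be any fractional schedule of this instance, with completion times $C_e$ and response times $\rho_e = C_e - r_e$. Then the optimal value of the linear program $$\text{minimize } \sum_{e\in F}\sum_{t\ge r_e}\Big(\frac{t-r_e}{d_e}+\frac{1}{2c_e}\Big) b_{et}$$ subject to $\sum_{t\ge r_e} b_{et}\ge d_e$ for all $e\in F$; $\sum_{e\in F_p} b_{et}\le c_p$ for all ports $p$ and rounds $t$; $b_{et}\ge 0$ for all $e,t$, is at most $\sum_{e\in F}\rho_e$.
   Context: A switch instance consists of a finite set $P$ of ports, partitioned into input ports and output ports, each port $p$ having a positive integer capacity $c_p$, and a finite set $F$ of flows. Each flow $e=pq$ goes from an input port $p$ to an output port $q$, and has a demand $d_e>0$ and a release time $r_e\in\mathbb{N}$ (time is divided into integer rounds); it is assumed that $d_e\le c_e:=\min(c_p,c_q)$. $F_p$ denotes the set of flows having $p$ as an endpoint. The variables $b_{et}$ of the linear program are indexed by flows $e$ and integer rounds $t\ge r_e$. A fractional (possibly non-integral) schedule is an assignment of amounts $x_{e,t}\ge 0$ to flows $e$ and rounds $t$ such that $x_{e,t}=0$ for $t<r_e$, $\sum_t x_{e,t}=d_e$ for every flow $e$, and $\sum_{e\in F_p} x_{e,t}\le c_p$ for every port $p$ and round $t$; the completion time of $e$ is $C_e=1+\max\{t: x_{e,t}>0\}$ and its response time is $\rho_e=C_e-r_e$.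
   Formalization: The demands $d_e$ and the amounts $x_{e,t}$ of the fractional schedule are rational rather than real. -}

module Defs where

open import Data.Bool using (Bool; true; false; if_then_else_; _∨_)
open import Data.Nat as ℕ using (ℕ; zero; suc; _⊓_)
open import Data.Fin using (Fin; zero; suc)
open import Data.Fin.Properties using (_≟_)
open import Data.Integer using (+_)
open import Data.Rational using (ℚ; 0ℚ; 1ℚ; _+_; _-_; _*_; _≤_; _<_; _/_; 1/_; _<?_; positive)
open import Data.Rational.Properties using (pos⇒nonZero)
open import Data.Nat.Properties using (⊓-pres-m<; m*n≢0)
open import Relation.Nullary.Decidable using (⌊_⌋)
open import Relation.Binary.PropositionalEquality using (_≡_)
open import Data.Product using (Σ; _×_; ∃-syntax)

ℕ→ℚ : ℕ → ℚ
ℕ→ℚ n = + n / 1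

sumℕ : ℕ → (ℕ → ℚ) → ℚ
sumℕ zero    f = 0ℚ
sumℕ (suc n) f = sumℕ n f + f n

sumFin : (n : ℕ) → (Fin n → ℚ) → ℚ
sumFin zero    f = 0ℚ
sumFin (suc n) f = f zero + sumFin n (λ i → f (suc i))

recip : (q : ℚ) → 0ℚ < q → ℚ
recip q h = (1/ q) {{pos⇒nonZero q {{positive h}}}}

record Instance : Set where
  field
    nP nF   : ℕ
    isInput : Fin nP → Bool
    cap     : Fin nP → ℕ
    cap-pos : ∀ p → 0 ℕ.< cap p
    src dst : Fin nF → Fin nP
    src-in  : ∀ e → isInput (src e) ≡ true
    dst-out : ∀ e → isInput (dst e) ≡ false
    dem     : Fin nF → ℚ
    dem-pos : ∀ e → 0ℚ < dem e
    rel     : Fin nF → ℕ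
    dem-le  : ∀ e → dem e ≤ ℕ→ℚ (cap (src e) ⊓ cap (dst e))

module _ (I : Instance) where
  open Instance I

  capF : Fin nF → ℕ
  capF e = cap (src e) ⊓ cap (dst e)

  incident : Fin nP → Fin nF → Bool
  incident p e = ⌊ src e ≟ p ⌋ ∨ ⌊ dst e ≟ p ⌋

  portLoad : (Fin nF → ℕ → ℚ) → Fin nP → ℕ → ℚ
  portLoad y p t = sumFin nF (λ e → if incident p e then y e t else 0ℚ)

  record Schedule : Set where
    field
      horizon  : ℕ
      x        : Fin nF → ℕ → ℚ
      x-nonneg : ∀ e t → 0ℚ ≤ x e t
      x-rel    : ∀ e t → t ℕ.< rel e → x e t ≡ 0ℚ
      x-fin    : ∀ e t → horizon ℕ.≤ t → x e t ≡ 0ℚ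
      x-dem    : ∀ e → sumℕ horizon (x e) ≡ dem e
      x-cap    : ∀ p t → portLoad x p t ≤ ℕ→ℚ (cap p)

  -- lastPos f T = 1 + max { t < T : f t > 0 }  (0 if no such t)
  lastPos : (ℕ → ℚ) → ℕ → ℕ
  lastPos f zero    = zero
  lastPos f (suc T) = if ⌊ 0ℚ <? f T ⌋ then suc T else lastPos f T

  completion : Schedule → Fin nF → ℕ
  completion S e = lastPos (Schedule.x S e) (Schedule.horizon S)

  response : Schedule → Fin nF → ℚ
  response S e = ℕ→ℚ (completion S e) - ℕ→ℚ (rel e)

  totalResponse : Schedule → ℚ
  totalResponse S = sumFin nF (response S)

  -- Feasible LP solution b_{et}; variables exist only for t ≥ r_e
  -- (b e t is fixed to 0 for t < r_e), and b is finitely supported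
  -- (zero for t ≥ horizon).
  record LPSolution : Set where
    field
      horizon  : ℕ
      b        : Fin nF → ℕ → ℚ
      b-nonneg : ∀ e t → 0ℚ ≤ b e t
      b-rel    : ∀ e t → t ℕ.< rel e → b e t ≡ 0ℚ
      b-fin    : ∀ e t → horizon ℕ.≤ t → b e t ≡ 0ℚ
      b-dem    : ∀ e → dem e ≤ sumℕ horizon (b e)
      b-cap    : ∀ p t → portLoad b p t ≤ ℕ→ℚ (cap p)

  capF-pos : ∀ e → 0 ℕ.< capF e
  capF-pos e = ⊓-pres-m< (cap-pos (src e)) (cap-pos (dst e))

  coeff : Fin nF → ℕ → ℚ
  coeff e t = (ℕ→ℚ t - ℕ→ℚ (rel e)) * recip (dem e) (dem-pos e)
            + (+ 1 / (2 ℕ.* capF e)) {{m*n≢0 2 (capF e) {{_}} {{ℕ.>-nonZero (capF-pos e)}}}}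

  objective : LPSolution → ℚ
  objective B = sumFin nF (λ e → sumℕ (LPSolution.horizon B)
                  (λ t → if ⌊ rel e ℕ.≤? t ⌋ then coeff e t * LPSolution.b B e t else 0ℚ))

  -- "the optimal value (infimum) of the LP is at most v":
  -- for every ε > 0 there is a feasible solution with objective < v + ε.
  LPOptAtMost : ℚ → Set
  LPOptAtMost v = ∀ (ε : ℚ) → 0ℚ < ε → Σ LPSolution (λ B → objective B < v + ε)

module Submission where

-- The schedule is itself a feasible LP solution, and its objective value is
-- at most the total response time, so the LP optimum is at most Σ_e ρ_e.
--
-- Feasibility is immediate: Σ_t x_{et} = d_e gives the demand constraints and
-- the port constraints are those of the schedule.  For the objective, fix a
-- flow e and a round t ≥ r_e carrying mass x_{et} > 0.  Then t < C_e, so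
--   (t - r_e)/d_e + 1/(2c_e) ≤ (t - r_e)/d_e + 1/d_e ≤ (C_e - r_e)/d_e ,
-- using d_e ≤ c_e ≤ 2c_e and 1 ≤ C_e - t.  Multiplying by x_{et} and summing
-- over t, the contribution of e is at most ((C_e - r_e)/d_e) · d_e = ρ_e.

open import Defs
open import Data.Bool using (if_then_else_)
open import Data.Nat as ℕ using (ℕ; zero; suc)
import Data.Nat.Properties as ℕP
open import Data.Fin as Fin using (Fin)
open import Data.Integer as ℤ using (+_)
import Data.Integer.Properties as ℤP
import Data.Nat.Coprimality as Cop
open import Data.Rational hiding (floor)
open import Data.Rational.Properties
open import Data.Rational.Solver using (module +-*-Solver)
open import Data.Product using (_,_)
open import Data.Sum using (inj₁; inj₂)
open import Data.Empty using (⊥-elim)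
open import Relation.Nullary using (yes; no)
open import Relation.Nullary.Decidable using (⌊_⌋)
open import Relation.Binary.PropositionalEquality

ℕ→ℚ-mkℚ : ∀ n → ℕ→ℚ n ≡ mkℚ (+ n) 0 (Cop.sym (Cop.1-coprimeTo n))
ℕ→ℚ-mkℚ n = normalize-coprime (Cop.sym (Cop.1-coprimeTo n))

ℕ→ℚ-+ : ∀ m n → ℕ→ℚ (m ℕ.+ n) ≡ ℕ→ℚ m + ℕ→ℚ n
ℕ→ℚ-+ m n = begin
  + (m ℕ.+ n) / 1                     ≡⟨ /-cong numerator refl ⟩
  (+ m ℤ.* + 1 ℤ.+ + n ℤ.* + 1) / 1   ≡⟨ sym (cong₂ _+_ (ℕ→ℚ-mkℚ m) (ℕ→ℚ-mkℚ n)) ⟩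
  ℕ→ℚ m + ℕ→ℚ n                       ∎
  where
  open ≡-Reasoning
  numerator : + (m ℕ.+ n) ≡ + m ℤ.* + 1 ℤ.+ + n ℤ.* + 1
  numerator = trans (ℤP.pos-+ m n)
                    (sym (cong₂ ℤ._+_ (ℤP.*-identityʳ (+ m)) (ℤP.*-identityʳ (+ n))))

ℕ→ℚ-mono : ∀ {m n} → m ℕ.≤ n → ℕ→ℚ m ≤ ℕ→ℚ n
ℕ→ℚ-mono {m} {n} m≤n rewrite ℕ→ℚ-mkℚ m | ℕ→ℚ-mkℚ n =
  *≤* (subst₂ ℤ._≤_ (sym (ℤP.*-identityʳ (+ m))) (sym (ℤP.*-identityʳ (+ n))) (ℤ.+≤+ m≤n))

one≤difference : ∀ {t C} → t ℕ.< C → 1ℚ ≤ ℕ→ℚ C - ℕ→ℚ t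
one≤difference {t} {C} t<C = begin
  1ℚ                         ≡⟨ solve 2 (λ o t → o := (o :+ t) :- t) refl 1ℚ (ℕ→ℚ t) ⟩
  (1ℚ + ℕ→ℚ t) - ℕ→ℚ t       ≡⟨ cong (_- ℕ→ℚ t) (sym (ℕ→ℚ-+ 1 t)) ⟩
  ℕ→ℚ (suc t) - ℕ→ℚ t        ≤⟨ +-monoˡ-≤ (- ℕ→ℚ t) (ℕ→ℚ-mono t<C) ⟩
  ℕ→ℚ C - ℕ→ℚ t              ∎
  where
  open ≤-Reasoning
  open +-*-Solver

recip-ℕ→ℚ : ∀ m .{{_ : ℕ.NonZero m}} (pos : 0ℚ < ℕ→ℚ m) → recip (ℕ→ℚ m) pos ≡ + 1 / m
recip-ℕ→ℚ (suc k) pos rewrite ℕ→ℚ-mkℚ (suc k) = sym (normalize-coprime (Cop.1-coprimeTo (suc k)))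

recip-pos : ∀ d (d>0 : 0ℚ < d) → Positive (recip d d>0)
recip-pos d d>0 = 1/pos⇒pos d {{positive d>0}}

recip-nonNeg : ∀ d (d>0 : 0ℚ < d) → 0ℚ ≤ recip d d>0
recip-nonNeg d d>0 = nonNegative⁻¹ (recip d d>0) {{pos⇒nonNeg (recip d d>0) {{recip-pos d d>0}}}}

recip-cancelʳ : ∀ a d (d>0 : 0ℚ < d) → (a * recip d d>0) * d ≡ a
recip-cancelʳ a d d>0 = begin
  (a * recip d d>0) * d   ≡⟨ *-assoc a (recip d d>0) d ⟩
  a * (recip d d>0 * d)   ≡⟨ cong (a *_) (*-inverseˡ d {{pos⇒nonZero d {{positive d>0}}}}) ⟩
  a * 1ℚ                  ≡⟨ *-identityʳ a ⟩
  a                       ∎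
  where open ≡-Reasoning

recip-antimono : ∀ p q (p>0 : 0ℚ < p) (q>0 : 0ℚ < q) → p ≤ q → recip q q>0 ≤ recip p p>0
recip-antimono p q p>0 q>0 p≤q = begin
  1/q                ≡⟨ sym (*-identityʳ 1/q) ⟩
  1/q * 1ℚ           ≡⟨ cong (1/q *_) (sym (*-inverseʳ p {{pos⇒nonZero p {{positive p>0}}}})) ⟩
  1/q * (p * 1/p)    ≤⟨ *-monoˡ-≤-nonNeg 1/q {{pos⇒nonNeg 1/q {{recip-pos q q>0}}}}
                          (*-monoʳ-≤-nonNeg 1/p {{pos⇒nonNeg 1/p {{recip-pos p p>0}}}} p≤q) ⟩
  1/q * (q * 1/p)    ≡⟨ sym (*-assoc 1/q q 1/p) ⟩
  (1/q * q) * 1/p    ≡⟨ cong (_* 1/p) (*-inverseˡ q {{pos⇒nonZero q {{positive q>0}}}}) ⟩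
  1ℚ * 1/p           ≡⟨ *-identityˡ 1/p ⟩
  1/p                ∎
  where
  open ≤-Reasoning
  1/p = recip p p>0
  1/q = recip q q>0

unitFraction≤recip : ∀ d (d>0 : 0ℚ < d) m .{{_ : ℕ.NonZero m}} → d ≤ ℕ→ℚ m → + 1 / m ≤ recip d d>0
unitFraction≤recip d d>0 m d≤m =
  subst (_≤ recip d d>0) (recip-ℕ→ℚ m m>0) (recip-antimono d (ℕ→ℚ m) d>0 m>0 d≤m)
  where
  m>0 : 0ℚ < ℕ→ℚ m
  m>0 = <-≤-trans d>0 d≤m

coefficient-bound : ∀ T R C i u → 0ℚ ≤ i → u ≤ i → 1ℚ ≤ C - T →
                    (T - R) * i + u ≤ (C - R) * i
coefficient-bound T R C i u i≥0 u≤i 1≤C-T = begin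
  (T - R) * i + u              ≤⟨ +-monoʳ-≤ ((T - R) * i) (≤-trans u≤i i≤[C-T]i) ⟩
  (T - R) * i + (C - T) * i    ≡⟨ sym (*-distribʳ-+ i (T - R) (C - T)) ⟩
  ((T - R) + (C - T)) * i      ≡⟨ cong (_* i) (telescope C R T) ⟩
  (C - R) * i                  ∎
  where
  open ≤-Reasoning
  open +-*-Solver
  i≤[C-T]i : i ≤ (C - T) * i
  i≤[C-T]i = subst (_≤ (C - T) * i) (*-identityˡ i) (*-monoʳ-≤-nonNeg i {{nonNegative i≥0}} 1≤C-T)
  telescope : ∀ C R T → (T - R) + (C - T) ≡ C - R
  telescope = solve 3 (λ C R T → (T :- R) :+ (C :- T) := C :- R) refl

*-monoʳ-≤-onSupport : ∀ {a b} x → 0ℚ ≤ x → (0ℚ < x → a ≤ b) → a * x ≤ b * x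
*-monoʳ-≤-onSupport {a} {b} x x≥0 a≤b with 0ℚ <? x
... | yes x>0 = *-monoʳ-≤-nonNeg x {{nonNegative x≥0}} (a≤b x>0)
... | no  x≯0 rewrite ≤-antisym (≮⇒≥ x≯0) x≥0 | *-zeroʳ a | *-zeroʳ b = ≤-refl

sumℕ-mono : ∀ n (f g : ℕ → ℚ) → (∀ t → t ℕ.< n → f t ≤ g t) → sumℕ n f ≤ sumℕ n g
sumℕ-mono zero    f g f≤g = ≤-refl
sumℕ-mono (suc n) f g f≤g =
  +-mono-≤ (sumℕ-mono n f g (λ t t<n → f≤g t (ℕP.m≤n⇒m≤1+n t<n))) (f≤g n ℕP.≤-refl)

sumℕ-*ˡ : ∀ n k (f : ℕ → ℚ) → sumℕ n (λ t → k * f t) ≡ k * sumℕ n f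
sumℕ-*ˡ zero    k f = sym (*-zeroʳ k)
sumℕ-*ˡ (suc n) k f =
  trans (cong (_+ k * f n) (sumℕ-*ˡ n k f)) (sym (*-distribˡ-+ k (sumℕ n f) (f n)))

sumFin-mono : ∀ n (f g : Fin n → ℚ) → (∀ i → f i ≤ g i) → sumFin n f ≤ sumFin n g
sumFin-mono zero    f g f≤g = ≤-refl
sumFin-mono (suc n) f g f≤g =
  +-mono-≤ (f≤g Fin.zero) (sumFin-mono n _ _ (λ i → f≤g (Fin.suc i)))

lastPos-after-support : ∀ I (f : ℕ → ℚ) T t → t ℕ.< T → 0ℚ < f t → t ℕ.< lastPos I f T
lastPos-after-support I f (suc T) t t<1+T ft>0 with 0ℚ <? f T
... | yes _ = t<1+T
... | no fT≯0 with ℕP.m≤n⇒m<n∨m≡n t<1+T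
...   | inj₁ t<T  = lastPos-after-support I f T t (ℕP.≤-pred t<T) ft>0
...   | inj₂ refl = ⊥-elim (fT≯0 ft>0)

module ScheduleAsLP (I : Instance) (S : Schedule I) where
  open Instance I
  open Schedule S

  solution : LPSolution I
  solution = record
    { horizon  = horizon
    ; b        = x
    ; b-nonneg = x-nonneg
    ; b-rel    = x-rel
    ; b-fin    = x-fin
    ; b-dem    = λ e → ≤-reflexive (sym (x-dem e))
    ; b-cap    = x-cap
    }

  term : Fin nF → ℕ → ℚ
  term e t = if ⌊ rel e ℕ.≤? t ⌋ then coeff I e t * x e t else 0ℚ

  rate : Fin nF → ℚ
  rate e = response I S e * recip (dem e) (dem-pos e)

  -- In a round t ≥ r_e carrying mass, the coefficient is at most ρ_e / d_e:
  -- 1/(2c_e) ≤ 1/d_e because d_e ≤ c_e ≤ 2c_e, and t < C_e.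
  coeff≤rate : ∀ e t → t ℕ.< horizon → 0ℚ < x e t → coeff I e t ≤ rate e
  coeff≤rate e t t<h xet>0 =
    coefficient-bound (ℕ→ℚ t) (ℕ→ℚ (rel e)) (ℕ→ℚ (completion I S e))
      (recip (dem e) (dem-pos e)) _ (recip-nonNeg (dem e) (dem-pos e))
      (unitFraction≤recip (dem e) (dem-pos e) (2 ℕ.* capF I e) {{2c≢0}} d≤2c)
      (one≤difference (lastPos-after-support I (x e) horizon t t<h xet>0))
    where
    2c≢0 : ℕ.NonZero (2 ℕ.* capF I e)
    2c≢0 = ℕP.m*n≢0 2 (capF I e) {{_}} {{ℕ.>-nonZero (capF-pos I e)}}
    d≤2c : dem e ≤ ℕ→ℚ (2 ℕ.* capF I e)
    d≤2c = ≤-trans (dem-le e) (ℕ→ℚ-mono (ℕP.m≤m+n (capF I e) (capF I e ℕ.+ 0)))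

  term≤ : ∀ e t → t ℕ.< horizon → term e t ≤ rate e * x e t
  term≤ e t t<h with rel e ℕ.≤? t
  ... | yes _  = *-monoʳ-≤-onSupport (x e t) (x-nonneg e t) (coeff≤rate e t t<h)
  ... | no r≰t = ≤-reflexive (sym (trans (cong (rate e *_) (x-rel e t (ℕP.≰⇒> r≰t))) (*-zeroʳ (rate e))))

  flow-bound : ∀ e → sumℕ horizon (term e) ≤ response I S e
  flow-bound e = begin
    sumℕ horizon (term e)                    ≤⟨ sumℕ-mono horizon _ _ (term≤ e) ⟩
    sumℕ horizon (λ t → rate e * x e t)      ≡⟨ sumℕ-*ˡ horizon (rate e) (x e) ⟩
    rate e * sumℕ horizon (x e)              ≡⟨ cong (rate e *_) (x-dem e) ⟩
    rate e * dem e                           ≡⟨ recip-cancelʳ (response I S e) (dem e) (dem-pos e) ⟩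
    response I S e                           ∎
    where open ≤-Reasoning

  objective≤totalResponse : objective I solution ≤ totalResponse I S
  objective≤totalResponse = sumFin-mono nF _ _ flow-bound

lemma3p1 : (I : Instance) (S : Schedule I) → LPOptAtMost I (totalResponse I S)
lemma3p1 I S ε ε>0 = solution , (begin-strict
  objective I solution         ≤⟨ objective≤totalResponse ⟩
  totalResponse I S            ≡⟨ sym (+-identityʳ (totalResponse I S)) ⟩
  totalResponse I S + 0ℚ       <⟨ +-monoʳ-< (totalResponse I S) ε>0 ⟩
  totalResponse I S + ε        ∎)
  where
  open ScheduleAsLP I S
  open ≤-Reasoning
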